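{- Let $\mathcal T$ be an extensional typed combinatory algebra. In $\mathbf{Asm}_{\mathcal{T}}$ the modest assemblies are closed under finite products and exponentials, and so are the basic assemblies. Moreover, the functor $E:\mathcal T\to\mathbf{Asm}_{\mathcal{T}}$ preserves the cartesian closed structure.
   Context: A typed combinatory algebra (tca) $\mathcal{T}$ consists of a set of types containing $\bot,\top,N$ and closed under $\times,\to,+$; sets $|T|$; total application maps $|S\to T|\times|S|\to|T|$, $(a,b)\mapsto ab$; and elements $\mathsf{exf},\mathsf t,\mathsf k,\mathsf s,\mathsf{pair},\mathsf{fst},\mathsf{snd},\mathsf{inl},\mathsf{inr},\mathsf{case},\mathsf 0,\mathsf{succ},\mathsf R$ of the appropriate types satisfying $\mathsf{k}ab=a$, $\mathsf{s}abc=ac(bc)$, $\mathsf{fst}(\mathsf{pair}ab)=a$, $\mathsf{snd}(\mathsf{pair}ab)=b$, $\mathsf{case}ab(\mathsf{inl}x)=ax$, $\mathsf{case}ab(\mathsf{inr}x)=bx$, $\mathsf{R}ab\mathsf{0}=a$, $\mathsf{R}ab(\mathsf{succ}n)=bn(\mathsf{R}abn)$. $\mathcal T$ is extensional if the maps $|S\times T|\to|S|\times|T|$, $x\mapsto(\mathsf{fst}x,\mathsf{snd}x)$ and $|T\to S|\to|S|^{|T|}$, $x\mapsto(y\mapsto xy)$ are injective and $|\top|=\{\mathsf t\}$. For extensional $\mathcal T$, the category also denoted $\mathcal T$ has types as objects, elements of $|A\to B|$ as morphisms; it is cartesian closed with products $A\times B$ and exponentials $A\to B$. An assembly over $\mathcal{T}$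 is $(X,A,\alpha)$ with $X$ a set, $A$ a type, $\alpha(x)\subseteq|A|$ inhabited; morphisms are functions $f:X\to Y$ with some $e\in|A\to B|$ such that $a\in\alpha(x)\Rightarrow ea\in\beta(f(x))$. In $\mathbf{Asm}_{\mathcal T}$ the product of $(X,A,\alpha),(Y,B,\beta)$ is $(X\times Y,A\times B,(x,y)\mapsto\{k:\mathsf{fst}k\in\alpha(x),\mathsf{snd}k\in\beta(y)\})$, the terminal object is $(\{0\},\top,0\mapsto\{\mathsf t\})$, and the exponential $X^Y$ is $(\mathrm{Hom}(Y,X),B\to A,\gamma)$ with $\gamma(f)$ the set of elements tracking $f$. $E$ sends $A$ to $(|A|,A,x\mapsto\{x\})$ and $f$ to $x\mapsto fx$. An assembly is modest if $a\in\alpha(x)\cap\alpha(y)$ implies $x=y$; strongly modest if moreover each $\alpha(x)$ is a singleton; exhaustive if every $a\in|A|$ lies in some $\alpha(x)$; basic if strongly modest and exhaustive. -}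

module Defs where

open import Level using (0ℓ)
open import Data.Product using (Σ; _×_; _,_; proj₁; proj₂)
open import Data.Unit using (⊤; tt)
open import Relation.Binary.PropositionalEquality as P using (_≡_; refl; sym; trans; cong; subst)
open import Relation.Binary.Bundles using (Setoid)
open import Data.Product.Relation.Binary.Pointwise.NonDependent using (×-setoid)

record TCA : Set₁ where
  infixr 6 _⇒_
  infixl 9 _·_
  field
    Ty   : Set
    ⊥ᵗ   : Ty
    ⊤ᵗ   : Ty
    N    : Ty
    _×ᵗ_ : Ty → Ty → Ty
    _⇒_  : Ty → Ty → Ty
    _+ᵗ_ : Ty → Ty → Ty
    ∣_∣  : Ty → Set
    _·_  : ∀ {S T} → ∣ S ⇒ T ∣ → ∣ S ∣ → ∣ T ∣
    exf  : ∀ {T} → ∣ ⊥ᵗ ⇒ T ∣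
    t    : ∣ ⊤ᵗ ∣
    k    : ∀ {S T} → ∣ S ⇒ T ⇒ S ∣
    s    : ∀ {R S T} → ∣ (R ⇒ S ⇒ T) ⇒ (R ⇒ S) ⇒ R ⇒ T ∣
    pair : ∀ {S T} → ∣ S ⇒ T ⇒ (S ×ᵗ T) ∣
    fst  : ∀ {S T} → ∣ (S ×ᵗ T) ⇒ S ∣
    snd  : ∀ {S T} → ∣ (S ×ᵗ T) ⇒ T ∣
    inl  : ∀ {S T} → ∣ S ⇒ (S +ᵗ T) ∣
    inr  : ∀ {S T} → ∣ T ⇒ (S +ᵗ T) ∣
    case : ∀ {R S T} → ∣ (S ⇒ R) ⇒ (T ⇒ R) ⇒ (S +ᵗ T) ⇒ R ∣
    zero : ∣ N ∣
    succ : ∣ N ⇒ N ∣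
    rec  : ∀ {T} → ∣ T ⇒ (N ⇒ T ⇒ T) ⇒ N ⇒ T ∣
    k-law    : ∀ {S T} (a : ∣ S ∣) (b : ∣ T ∣) → k {S} {T} · a · b ≡ a
    s-law    : ∀ {R S T} (a : ∣ R ⇒ S ⇒ T ∣) (b : ∣ R ⇒ S ∣) (c : ∣ R ∣) →
               s {R} {S} {T} · a · b · c ≡ (a · c) · (b · c)
    fst-law  : ∀ {S T} (a : ∣ S ∣) (b : ∣ T ∣) → fst {S} {T} · (pair {S} {T} · a · b) ≡ a
    snd-law  : ∀ {S T} (a : ∣ S ∣) (b : ∣ T ∣) → snd {S} {T} · (pair {S} {T} · a · b) ≡ b
    case-inl : ∀ {R S T} (a : ∣ S ⇒ R ∣) (b : ∣ T ⇒ R ∣) (x : ∣ S ∣) →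
               case {R} {S} {T} · a · b · (inl {S} {T} · x) ≡ a · x
    case-inr : ∀ {R S T} (a : ∣ S ⇒ R ∣) (b : ∣ T ⇒ R ∣) (x : ∣ T ∣) →
               case {R} {S} {T} · a · b · (inr {S} {T} · x) ≡ b · x
    rec-zero : ∀ {T} (a : ∣ T ∣) (b : ∣ N ⇒ T ⇒ T ∣) → rec {T} · a · b · zero ≡ a
    rec-succ : ∀ {T} (a : ∣ T ∣) (b : ∣ N ⇒ T ⇒ T ∣) (n : ∣ N ∣) →
               rec {T} · a · b · (succ · n) ≡ b · n · (rec {T} · a · b · n)

record IsExtensional (𝒯 : TCA) : Set where
  open TCA 𝒯
  field
    pair-inj : ∀ {S T} (x y : ∣ S ×ᵗ T ∣) →
               fst {S} {T} · x ≡ fst {S} {T} · y → snd {S} {T} · x ≡ snd {S} {T} · y → x ≡ y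
    fun-inj  : ∀ {S T} (x y : ∣ T ⇒ S ∣) → (∀ z → x · z ≡ y · z) → x ≡ y
    ⊤-unique : ∀ (x : ∣ ⊤ᵗ ∣) → x ≡ t

module Asm (𝒯 : TCA) where
  open TCA 𝒯

  record Assembly : Set₁ where
    field
      X         : Setoid 0ℓ 0ℓ
      A         : Ty
      α         : Setoid.Carrier X → ∣ A ∣ → Set
      α-resp    : ∀ {x y a} → Setoid._≈_ X x y → α x a → α y a
      inhabited : ∀ x → Σ ∣ A ∣ (α x)

  open Assembly public

  Car : Assembly → Set
  Car 𝑿 = Setoid.Carrier (X 𝑿)

  record Hom (𝑿 𝒀 : Assembly) : Set where
    field
      fun     : Car 𝑿 → Car 𝒀
      fun-cong : ∀ {x x'} → Setoid._≈_ (X 𝑿) x x' → Setoid._≈_ (X 𝒀) (fun x) (fun x')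
      tracker : ∣ A 𝑿 ⇒ A 𝒀 ∣
      tracks  : ∀ x a → α 𝑿 x a → α 𝒀 (fun x) (tracker · a)

  open Hom public

  _≈ᴴ_ : ∀ {𝑿 𝒀} → Hom 𝑿 𝒀 → Hom 𝑿 𝒀 → Set
  _≈ᴴ_ {𝑿} {𝒀} f g = ∀ x → Setoid._≈_ (X 𝒀) (fun f x) (fun g x)

  HomSetoid : Assembly → Assembly → Setoid 0ℓ 0ℓ
  HomSetoid 𝑿 𝒀 = record
    { Carrier = Hom 𝑿 𝒀
    ; _≈_ = _≈ᴴ_
    ; isEquivalence = record
      { refl  = λ x → Setoid.refl (X 𝒀)
      ; sym   = λ p x → Setoid.sym (X 𝒀) (p x)
      ; trans = λ p q x → Setoid.trans (X 𝒀) (p x) (q x)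
      }
    }

  record Iso (𝑿 𝒀 : Assembly) : Set where
    field
      to      : Hom 𝑿 𝒀
      from    : Hom 𝒀 𝑿
      from-to : ∀ x → Setoid._≈_ (X 𝑿) (fun from (fun to x)) x
      to-from : ∀ y → Setoid._≈_ (X 𝒀) (fun to (fun from y)) y

  open Iso public

  𝟏 : Assembly
  𝟏 = record
    { X = P.setoid ⊤
    ; A = ⊤ᵗ
    ; α = λ _ a → a ≡ t
    ; α-resp = λ _ p → p
    ; inhabited = λ _ → t , refl
    }

  _⊗_ : Assembly → Assembly → Assembly
  𝑿 ⊗ 𝒀 = record
    { X = ×-setoid (X 𝑿) (X 𝒀)
    ; A = A 𝑿 ×ᵗ A 𝒀
    ; α = λ { (x , y) c → α 𝑿 x (fst {A 𝑿} {A 𝒀} · c) × α 𝒀 y (snd {A 𝑿} {A 𝒀} · c) }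
    ; α-resp = λ { (p , q) (u , v) → α-resp 𝑿 p u , α-resp 𝒀 q v }
    ; inhabited = λ { (x , y) →
        pair {A 𝑿} {A 𝒀} · proj₁ (inhabited 𝑿 x) · proj₁ (inhabited 𝒀 y)
        , subst (α 𝑿 x) (sym (fst-law _ _)) (proj₂ (inhabited 𝑿 x))
        , subst (α 𝒀 y) (sym (snd-law _ _)) (proj₂ (inhabited 𝒀 y)) }
    }

  _^ᴬ_ : Assembly → Assembly → Assembly
  𝑿 ^ᴬ 𝒀 = record
    { X = HomSetoid 𝒀 𝑿
    ; A = A 𝒀 ⇒ A 𝑿
    ; α = λ f e → ∀ y b → α 𝒀 y b → α 𝑿 (fun f y) (e · b)
    ; α-resp = λ p u y b v → α-resp 𝑿 (p y) (u y b v)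
    ; inhabited = λ f → tracker f , tracks f
    }

  E : Ty → Assembly
  E A = record
    { X = P.setoid ∣ A ∣
    ; A = A
    ; α = λ x a → a ≡ x
    ; α-resp = λ p q → trans q p
    ; inhabited = λ x → x , refl
    }

  Modest : Assembly → Set
  Modest 𝑿 = ∀ x y a → α 𝑿 x a → α 𝑿 y a → Setoid._≈_ (X 𝑿) x y

  StronglyModest : Assembly → Set
  StronglyModest 𝑿 = Modest 𝑿 × (∀ x a b → α 𝑿 x a → α 𝑿 x b → a ≡ b)

  Exhaustive : Assembly → Set
  Exhaustive 𝑿 = ∀ (a : ∣ A 𝑿 ∣) → Σ (Car 𝑿) (λ x → α 𝑿 x a)

  Basic : Assembly → Set
  Basic 𝑿 = StronglyModest 𝑿 × Exhaustive 𝑿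

  EPreservesCCC : Set
  EPreservesCCC =
      Iso (E ⊤ᵗ) 𝟏
    × (∀ S T → Σ (Iso (E (S ×ᵗ T)) (E S ⊗ E T))
                 (λ i → ∀ x → fun (to i) x ≡ (fst {S} {T} · x , snd {S} {T} · x)))
    × (∀ S T → Σ (Iso (E (S ⇒ T)) (E T ^ᴬ E S))
                 (λ i → ∀ x a → fun (fun (to i) x) a ≡ x · a))

{-# OPTIONS --safe #-}
-- Realizers of a product are pairs of realizers and realizers of an exponential are
-- trackers; since every element of an assembly has a realizer, a morphism is pinned
-- down by what its trackers do, which gives modesty of exponentials. Uniqueness of
-- realizers in products and exponentials is precisely extensionality of the tca (for
-- exponentials, applied on an exhaustive domain), and an exponential of basic
-- assemblies is exhaustive because over a uniquely realized domain and a modest,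
-- exhaustive codomain every e : B → A tracks a function. For E, extensionality makes
-- the canonical comparison maps bijective, and they are all tracked by I = s k k.
module Submission where

open import Defs
open import Data.Product using (_×_; _,_; proj₁; proj₂; Σ)
open import Data.Unit using (tt)
open import Relation.Binary.PropositionalEquality using (_≡_; refl; sym; trans; cong; cong₂; subst)

module Closure (𝒯 : TCA) where
  open TCA 𝒯
  open Asm 𝒯

  UniquelyRealized : Assembly → Set
  UniquelyRealized 𝑿 = ∀ x a b → α 𝑿 x a → α 𝑿 x b → a ≡ b

  I : ∀ {S} → ∣ S ⇒ S ∣
  I {S} = s {S} {S ⇒ S} {S} · k · k

  I-law : ∀ {S} (a : ∣ S ∣) → I · a ≡ a
  I-law a = trans (s-law _ _ a) (k-law a _)

  modest-𝟏 : Modest 𝟏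
  modest-𝟏 tt tt _ _ _ = refl

  modest-⊗ : ∀ 𝑿 𝒀 → Modest 𝑿 → Modest 𝒀 → Modest (𝑿 ⊗ 𝒀)
  modest-⊗ 𝑿 𝒀 mX mY (x , y) (x' , y') c (u , v) (u' , v') =
    mX x x' _ u u' , mY y y' _ v v'

  modest-^ : ∀ 𝑿 𝒀 → Modest 𝑿 → Modest 𝒀 → Modest (𝑿 ^ᴬ 𝒀)
  modest-^ 𝑿 𝒀 mX _ f g e u v y with inhabited 𝒀 y
  ... | b , b∈y = mX (fun f y) (fun g y) (e · b) (u y b b∈y) (v y b b∈y)

  uniquelyRealized-𝟏 : UniquelyRealized 𝟏
  uniquelyRealized-𝟏 _ _ _ a≡t b≡t = trans a≡t (sym b≡t)

  exhaustive-⊗ : ∀ 𝑿 𝒀 → Exhaustive 𝑿 → Exhaustive 𝒀 → Exhaustive (𝑿 ⊗ 𝒀)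
  exhaustive-⊗ 𝑿 𝒀 eX eY c with eX (fst · c) | eY (snd · c)
  ... | x , u | y , v = (x , y) , u , v

  module _ (𝑿 𝒀 : Assembly) (mX : Modest 𝑿) (eX : Exhaustive 𝑿)
           (uY : UniquelyRealized 𝒀) (e : ∣ A 𝒀 ⇒ A 𝑿 ∣) where

    private
      image : Car 𝒀 → Car 𝑿
      image y = proj₁ (eX (e · proj₁ (inhabited 𝒀 y)))

      image-tracked : ∀ y b → α 𝒀 y b → α 𝑿 (image y) (e · b)
      image-tracked y b b∈y =
        subst (λ b′ → α 𝑿 (image y) (e · b′)) (uY y _ b (proj₂ (inhabited 𝒀 y)) b∈y)
              (proj₂ (eX (e · proj₁ (inhabited 𝒀 y))))

    homTrackedBy : Hom 𝒀 𝑿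
    homTrackedBy = record
      { fun      = image
      ; fun-cong = λ {y} {y'} y≈y' →
          let (b , b∈y) = inhabited 𝒀 y
          in mX (image y) (image y') (e · b)
                (image-tracked y b b∈y) (image-tracked y' b (α-resp 𝒀 y≈y' b∈y))
      ; tracker  = e
      ; tracks   = image-tracked
      }

  exhaustive-^ : ∀ 𝑿 𝒀 → Modest 𝑿 → Exhaustive 𝑿 → UniquelyRealized 𝒀 →
                 Exhaustive (𝑿 ^ᴬ 𝒀)
  exhaustive-^ 𝑿 𝒀 mX eX uY e =
    homTrackedBy 𝑿 𝒀 mX eX uY e , tracks (homTrackedBy 𝑿 𝒀 mX eX uY e)

  E₁ : ∀ {S T} → ∣ S ⇒ T ∣ → Hom (E S) (E T)
  E₁ x = record { fun = x ·_ ; fun-cong = cong (x ·_) ; tracker = x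
                ; tracks = λ _ _ → cong (x ·_) }

  tracker-E : ∀ {S T} (f : Hom (E S) (E T)) a → tracker f · a ≡ fun f a
  tracker-E f a = tracks f a a refl

  module _ (ext : IsExtensional 𝒯) where
    open IsExtensional ext

    exhaustive-𝟏 : Exhaustive 𝟏
    exhaustive-𝟏 a = tt , ⊤-unique a

    uniquelyRealized-⊗ : ∀ 𝑿 𝒀 → UniquelyRealized 𝑿 → UniquelyRealized 𝒀 →
                         UniquelyRealized (𝑿 ⊗ 𝒀)
    uniquelyRealized-⊗ 𝑿 𝒀 uX uY (x , y) c c' (u , v) (u' , v') =
      pair-inj c c' (uX x _ _ u u') (uY y _ _ v v')

    uniquelyRealized-^ : ∀ 𝑿 𝒀 → UniquelyRealized 𝑿 → Exhaustive 𝒀 →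
                         UniquelyRealized (𝑿 ^ᴬ 𝒀)
    uniquelyRealized-^ 𝑿 𝒀 uX eY f e e' u u' = fun-inj e e' λ b →
      let (y , b∈y) = eY b in uX (fun f y) _ _ (u y b b∈y) (u' y b b∈y)

    basic-𝟏 : Basic 𝟏
    basic-𝟏 = (modest-𝟏 , uniquelyRealized-𝟏) , exhaustive-𝟏

    basic-⊗ : ∀ 𝑿 𝒀 → Basic 𝑿 → Basic 𝒀 → Basic (𝑿 ⊗ 𝒀)
    basic-⊗ 𝑿 𝒀 ((mX , uX) , eX) ((mY , uY) , eY) =
      (modest-⊗ 𝑿 𝒀 mX mY , uniquelyRealized-⊗ 𝑿 𝒀 uX uY) , exhaustive-⊗ 𝑿 𝒀 eX eY

    basic-^ : ∀ 𝑿 𝒀 → Basic 𝑿 → Basic 𝒀 → Basic (𝑿 ^ᴬ 𝒀)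
    basic-^ 𝑿 𝒀 ((mX , uX) , eX) ((mY , uY) , eY) =
      (modest-^ 𝑿 𝒀 mX mY , uniquelyRealized-^ 𝑿 𝒀 uX eY) , exhaustive-^ 𝑿 𝒀 mX eX uY

    ≡-pair : ∀ {S T} (c : ∣ S ×ᵗ T ∣) u v →
             fst {S} {T} · c ≡ u → snd {S} {T} · c ≡ v → c ≡ pair · u · v
    ≡-pair c u v p q = pair-inj _ _ (trans p (sym (fst-law u v))) (trans q (sym (snd-law u v)))

    realizer-E^E : ∀ {S T} (f : Hom (E S) (E T)) e → α (E T ^ᴬ E S) f e → e ≡ tracker f
    realizer-E^E f e e⊩f = fun-inj _ _ λ a → trans (e⊩f a a refl) (sym (tracker-E f a))

    E-terminal : Iso (E ⊤ᵗ) 𝟏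
    E-terminal = record
      { to      = record { fun = λ _ → tt ; fun-cong = λ _ → refl
                         ; tracker = I ; tracks = λ _ _ _ → ⊤-unique _ }
      ; from    = record { fun = λ _ → t ; fun-cong = λ _ → refl
                         ; tracker = I ; tracks = λ _ a a≡t → trans (I-law a) a≡t }
      ; from-to = λ x → sym (⊤-unique x)
      ; to-from = λ _ → refl
      }

    E-product : ∀ S T → Σ (Iso (E (S ×ᵗ T)) (E S ⊗ E T))
                  (λ i → ∀ x → fun (to i) x ≡ (fst {S} {T} · x , snd {S} {T} · x))
    E-product S T = record
      { to      = record
          { fun      = λ x → fst {S} {T} · x , snd {S} {T} · x
          ; fun-cong = λ x≡x' → cong (fst ·_) x≡x' , cong (snd ·_) x≡x'
          ; tracker  = I
          ; tracks   = λ x a a≡x → cong (fst ·_) (trans (I-law a) a≡x)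
                                  , cong (snd ·_) (trans (I-law a) a≡x)
          }
      ; from    = record
          { fun      = λ (u , v) → pair {S} {T} · u · v
          ; fun-cong = λ (p , q) → cong₂ (λ u v → pair · u · v) p q
          ; tracker  = I
          ; tracks   = λ (u , v) c (p , q) → trans (I-law c) (≡-pair c u v p q)
          }
      ; from-to = λ x → sym (≡-pair x _ _ refl refl)
      ; to-from = λ (u , v) → fst-law u v , snd-law u v
      } , λ _ → refl

    E-exponential : ∀ S T → Σ (Iso (E (S ⇒ T)) (E T ^ᴬ E S))
                      (λ i → ∀ x a → fun (fun (to i) x) a ≡ x · a)
    E-exponential S T = record
      { to      = record
          { fun      = E₁
          ; fun-cong = λ x≡x' a → cong (_· a) x≡x'
          ; tracker  = I
          ; tracks   = λ x e e≡x a b b≡a → cong₂ _·_ (trans (I-law e) e≡x) b≡a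
          }
      ; from    = record
          { fun      = tracker
          ; fun-cong = λ {f} {g} f≈g → fun-inj _ _ λ a →
              trans (tracker-E f a) (trans (f≈g a) (sym (tracker-E g a)))
          ; tracker  = I
          ; tracks   = λ f e e⊩f → trans (I-law e) (realizer-E^E f e e⊩f)
          }
      ; from-to = λ _ → refl
      ; to-from = tracker-E
      } , λ _ _ → refl

mainTheorem13 : (𝒯 : TCA) → IsExtensional 𝒯 →
    let open Asm 𝒯 in
      (Modest 𝟏
        × (∀ 𝑿 𝒀 → Modest 𝑿 → Modest 𝒀 → Modest (𝑿 ⊗ 𝒀))
        × (∀ 𝑿 𝒀 → Modest 𝑿 → Modest 𝒀 → Modest (𝑿 ^ᴬ 𝒀)))
    × (Basic 𝟏
        × (∀ 𝑿 𝒀 → Basic 𝑿 → Basic 𝒀 → Basic (𝑿 ⊗ 𝒀))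
        × (∀ 𝑿 𝒀 → Basic 𝑿 → Basic 𝒀 → Basic (𝑿 ^ᴬ 𝒀)))
    × EPreservesCCC
mainTheorem13 𝒯 ext =
    (modest-𝟏 , modest-⊗ , modest-^)
  , (basic-𝟏 ext , basic-⊗ ext , basic-^ ext)
  , (E-terminal ext , E-product ext , E-exponential ext)
  where open Closure 𝒯
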